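{- Let $G_\tau$ be a bidirected graph. A partial graph $H_\tau$ of $G_\tau$ is a transitive reduction of $G_\tau$ if, and only if, $H_\tau$ is minimal (among partial graphs of $G_\tau$) such that $G_\tau$ is a partial graph of $\mathrm{Ft}(H_\tau)$.
   Context: A graph $G=(V,E)$ is finite, with loops and multiple edges allowed. A half-edge is a pair $(e,x)$ with $e$ incident with $x$ (a loop has two half-edges at its vertex). A bidirected graph $G_\tau=(V,E;\tau)$ is a graph with a map $\tau$ assigning $+1$ or $-1$ to every half-edge; an edge with ends $x,y$ and $\tau(e,x)=\alpha,\tau(e,y)=\beta$ is written $\{x^\alpha,y^\beta\}$. A partial graph of $G_\tau$ is $(V,F;\tau|_F)$ with $F\subseteq E$. A chain is $x_0,e_1,x_1,\ldots,e_k,x_k$ where $e_i$ has ends $x_{i-1},x_i$; when $e_i$ is traversed from $x_{i-1}$ to $x_i$, $\tau(e_i,x_{i-1}),\tau(e_i,x_i)$ denote the values at the corresponding half-edges. For $\alpha,\beta\in\{\pm1\}$ a b-walk from $x^\alpha$ to $y^\beta$ is a chain $x=x_0,e_1,\ldots,e_k,x_k=y$ with $k\ge1$, $\tau(e_1,x_0)=\alpha$, $\tau(e_k,x_k)=\beta$ and $\tau(e_i,x_i)+\tau(e_{i+1},x_i)=0$ for $1\le i\le k-1$. A b-path from $x^\alpha$ to $y^\beta$ is a b-walk from $x^\alpha$ to $y^\beta$ minimal with these properties (no b-walk from $x^\alpha$ to $y^\beta$ has as edge sequence a proper subsequence, in the same order, of its edge sequence); $x=y$ allowed. The transitive closure $\mathrm{Ft}(G_\tau)$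 is the bidirected graph on $V$ whose edges are those of $G_\tau$ together with an edge $\{x^\alpha,y^\beta\}$ (a loop if $x=y$) for every $x^\alpha,y^\beta$ such that $G_\tau$ has a b-path from $x^\alpha$ to $y^\beta$. For a partial graph $H_\tau$ of $G_\tau$, $\mathrm{ft}(G_\tau;H_\tau)$ is the partial graph of $G_\tau$ whose edges are the edges of $G_\tau$ that are edges of $H_\tau$ or are of the form $\{x^\alpha,y^\beta\}$ with a b-path from $x^\alpha$ to $y^\beta$ in $H_\tau$. A transitive reduction of $G_\tau$ is a minimal partial graph $R$ of $G_\tau$ with $\mathrm{ft}(G_\tau;R)=G_\tau$. -}

module Defs where

open import Data.Nat using (ℕ; _<_)
open import Data.Bool using (Bool; not)
open import Data.Fin using (Fin)
open import Data.Fin.Subset using (Subset; _∈_; _⊂_)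
open import Data.List using (List; []; _∷_; [_]; map; length)
open import Data.List.Relation.Binary.Sublist.Propositional using ()
  renaming (_⊆_ to _⊑_)
open import Data.Product using (Σ; ∃; _×_; _,_; proj₁)
open import Data.Sum using (_⊎_)
open import Relation.Binary.PropositionalEquality using (_≡_)
open import Relation.Nullary using (¬_)

data Sign : Set where
  plus minus : Sign

opp : Sign → Sign
opp plus  = minus
opp minus = plus

-- A finite bidirected graph with vertices Fin n and edges Fin m
-- (loops and multiple edges allowed).  Each edge e has two half-edges,
-- indexed by a side s : Bool; the half-edge (e,s) sits at vertex end e s
-- and carries the value τ e s.  A loop is an edge with end e true ≡ end e false,
-- so it has two distinct half-edges at its vertex.
record BGraph : Set where
  field
    n   : ℕ
    m   : ℕ
    end : Fin m → Bool → Fin n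
    τ   : Fin m → Bool → Sign

module _ (G : BGraph) where
  open BGraph G

  -- A step of a chain: traverse edge e from its half-edge on side s
  -- to its half-edge on side (not s).
  Step : Set
  Step = Fin m × Bool

  edges : List Step → List (Fin m)
  edges = map proj₁

  -- Consecutive condition τ(e_i,x_i) + τ(e_{i+1},x_i) = 0 is encoded by
  -- requiring the next step to start with sign opp (τ e (not s)).
  data BWalk (F : Subset m) : Fin n → Sign → Fin n → Sign → List Step → Set where
    single : ∀ e s → e ∈ F →
      BWalk F (end e s) (τ e s) (end e (not s)) (τ e (not s)) [ (e , s) ]
    cons : ∀ e s {y β w} → e ∈ F →
      BWalk F (end e (not s)) (opp (τ e (not s))) y β w →
      BWalk F (end e s) (τ e s) y β ((e , s) ∷ w)

  BPath : Subset m → Fin n → Sign → Fin n → Sign → List Step → Set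
  BPath F x α y β w =
    BWalk F x α y β w ×
    (∀ w' → BWalk F x α y β w' →
      ¬ ((edges w' ⊑ edges w) × (length w' < length w)))

  HasForm : Fin m → Fin n → Sign → Fin n → Sign → Set
  HasForm e x α y β =
    Σ Bool λ s → (end e s ≡ x) × (τ e s ≡ α) × (end e (not s) ≡ y) × (τ e (not s) ≡ β)

  IsEdgeOfFt : Subset m → Fin m → Set
  IsEdgeOfFt F e =
    (e ∈ F) ⊎
    (∃ λ x → ∃ λ α → ∃ λ y → ∃ λ β →
      (∃ λ w → BPath F x α y β w) × HasForm e x α y β)

  PartialGraphOfFt : Subset m → Set
  PartialGraphOfFt F = ∀ e → IsEdgeOfFt F e

  InFt : Subset m → Fin m → Set
  InFt F e =
    (e ∈ F) ⊎
    (∃ λ x → ∃ λ α → ∃ λ y → ∃ λ β →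
      HasForm e x α y β × (∃ λ w → BPath F x α y β w))

  ftIsG : Subset m → Set
  ftIsG F = ∀ e → InFt F e

  IsTransitiveReduction : Subset m → Set
  IsTransitiveReduction R =
    ftIsG R × (∀ R' → R' ⊂ R → ¬ ftIsG R')

  IsMinimalFtGenerating : Subset m → Set
  IsMinimalFtGenerating H =
    PartialGraphOfFt H × (∀ H' → H' ⊂ H → ¬ PartialGraphOfFt H')

{-# OPTIONS --safe #-}
module Submission where

open import Defs
open import Data.Fin.Subset using (Subset)
open import Data.Product using (_×_; _,_; map₂; swap)
import Data.Sum as Sum
open import Function.Bundles using (Equivalence; _⇔_; mk⇔)
open import Relation.Nullary using (¬_)

minimal-resp-⇔ : {A : Set} {_<_ : A → A → Set} {P Q : A → Set} →
  (∀ x → P x ⇔ Q x) →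
  ∀ x → (P x × (∀ y → y < x → ¬ P y)) ⇔ (Q x × (∀ y → y < x → ¬ Q y))
minimal-resp-⇔ P⇔Q x = mk⇔
  (λ (Px , minP) → to (P⇔Q x) Px , λ y y<x Qy → minP y y<x (from (P⇔Q y) Qy))
  (λ (Qx , minQ) → from (P⇔Q x) Qx , λ y y<x Py → minQ y y<x (to (P⇔Q y) Py))
  where open Equivalence

module _ (G : BGraph) where

  InFt⇔IsEdgeOfFt : ∀ F e → InFt G F e ⇔ IsEdgeOfFt G F e
  InFt⇔IsEdgeOfFt F e = mk⇔
    (Sum.map₂ (map₂ (map₂ (map₂ (map₂ swap)))))
    (Sum.map₂ (map₂ (map₂ (map₂ (map₂ swap)))))

  ftIsG⇔PartialGraphOfFt : ∀ F → ftIsG G F ⇔ PartialGraphOfFt G F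
  ftIsG⇔PartialGraphOfFt F = mk⇔
    (λ ft e → Equivalence.to (InFt⇔IsEdgeOfFt F e) (ft e))
    (λ pg e → Equivalence.from (InFt⇔IsEdgeOfFt F e) (pg e))

proposition36 : (G : BGraph) (H : Subset (BGraph.m G)) →
    IsTransitiveReduction G H ⇔ IsMinimalFtGenerating G H
proposition36 G = minimal-resp-⇔ (ftIsG⇔PartialGraphOfFt G)
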